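{- For every positive integer $n$, $$h_2(n) = \sum_{k=1}^{\lfloor (n+1)/3 \rfloor} \binom{2k-1}{k} \binom{n-2k}{k-1}.$$
   Context: For a binary sequence $x = (x_1,\dots,x_n) \in \{0,1\}^n$ define the score $$S(x) = \sum_{i=1}^{n-1} I[x_i = x_{i+1} = 1] - \sum_{i=1}^{n-1} I[x_i = 1,\ x_{i+1} = 0].$$ Let $h_2(n)$ be the number of $x \in \{0,1\}^n$ with $x_n = 1$ and $S(x) = 1$. An empty sum equals $0$. -}

module Defs where

open import Data.Nat using (ℕ; zero; suc; _+_; _*_; _∸_; _/_)
open import Data.Nat.Combinatorics using (_C_)
open import Data.Bool using (Bool; true; false; _∧_)
open import Data.Vec using (Vec; []; _∷_)
open import Data.List using (List; []; _∷_; map; _++_; length; filter; sum; upTo)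
open import Data.Integer using (ℤ; +_; _-_)
open import Relation.Binary.PropositionalEquality using (_≡_)
open import Relation.Nullary using (Dec; yes; no)
open import Data.Integer using () renaming (_≟_ to _≟ℤ_)
open import Data.Bool using () renaming (_≟_ to _≟B_)
open import Data.Product using (_×_; _,_)
open import Relation.Nullary.Decidable using (_×-dec_)

allSeqs : (n : ℕ) → List (Vec Bool n)
allSeqs zero = [] ∷ []
allSeqs (suc n) = map (false ∷_) (allSeqs n) ++ map (true ∷_) (allSeqs n)

count11 : {n : ℕ} → Vec Bool n → ℕ
count11 [] = 0
count11 (a ∷ []) = 0
count11 (true ∷ true ∷ xs) = suc (count11 (true ∷ xs))
count11 (a ∷ b ∷ xs) = count11 (b ∷ xs)

count10 : {n : ℕ} → Vec Bool n → ℕ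
count10 [] = 0
count10 (a ∷ []) = 0
count10 (true ∷ false ∷ xs) = suc (count10 (false ∷ xs))
count10 (a ∷ b ∷ xs) = count10 (b ∷ xs)

score : {n : ℕ} → Vec Bool n → ℤ
score x = + count11 x - + count10 x

-- x_n = 1 (false for the empty sequence, which has no last entry)
lastIsOne : {n : ℕ} → Vec Bool n → Bool
lastIsOne [] = false
lastIsOne (a ∷ []) = a
lastIsOne (a ∷ b ∷ xs) = lastIsOne (b ∷ xs)

good? : {n : ℕ} → (x : Vec Bool n) → Dec ((lastIsOne x ≡ true) × (score x ≡ + 1))
good? x = (lastIsOne x ≟B true) ×-dec (score x ≟ℤ + 1)

h₂ : ℕ → ℕ
h₂ n = length (filter good? (allSeqs n))

sumFrom1 : ℕ → (ℕ → ℕ) → ℕ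
sumFrom1 zero f = 0
sumFrom1 (suc m) f = sumFrom1 m f + f (suc m)

rhs : ℕ → ℕ
rhs n = sumFrom1 ((n + 1) / 3) (λ k → ((2 * k ∸ 1) C k) * ((n ∸ 2 * k) C (k ∸ 1)))

{-# OPTIONS --safe #-}
-- A sequence that ends in 1 and has p pairs 11 and q pairs 10 consists of q + 1 blocks
-- of ones, of total length p + q + 1, separated by q nonempty blocks of zeros and possibly
-- preceded by one more block of zeros. Peeling off the first letter, the number N of such
-- sequences satisfies Pascal-type recurrences, solved by C(p + q, q) (the block lengths of
-- the ones) times a number of compositions (the block lengths of the zeros). Now S(x) = 1
-- means p = q + 1, so h₂(n) is the sum over k = p of these closed forms; the terms with
-- 3k > n + 1 vanish, the others are C(2k - 1, k) C(n - 2k, k - 1).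
module Submission where

open import Defs
open import Data.Nat using (ℕ; suc)
open import Relation.Binary.PropositionalEquality using (_≡_)

open import Data.Bool using (Bool; true; false; _∧_)
open import Data.Bool.Properties using (∧-zeroʳ; T-≡)
open import Data.Integer as ℤ using (_⊖_)
open import Data.Integer.Properties using (+-injective; [1+m]⊖[1+n]≡m⊖n; [+m]-[+n]≡m⊖n)
open import Data.List using (List; []; _∷_; map; _++_; length; filter)
open import Data.List.Properties using (map-++; map-∘; map-cong)
open import Data.Nat using (zero; _+_; _*_; _∸_; _/_; _≤_; _<_; _≡ᵇ_; _≟_; pred; z≤n; s≤s; s≤s⁻¹; z<s; NonZero)
open import Data.Nat.Combinatorics using (_C_; nCn≡1; nCk≡nC[n∸k]; nCk+nC[k+1]≡[n+1]C[k+1]; k>n⇒nCk≡0)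
open import Data.Nat.DivMod using (m/n*n≤m; m/n≤m; m*n/n≡m; /-monoˡ-≤)
open import Data.Nat.ListAction using (sum)
open import Data.Nat.ListAction.Properties using (sum-++)
open import Data.Nat.Properties
open import Algebra.Properties.CommutativeSemigroup +-commutativeSemigroup using (interchange)
open import Data.Nat.Tactic.RingSolver using (solve-∀)
open import Data.Product.Function.NonDependent.Propositional using (_×-⇔_)
open import Data.Sum using (inj₁; inj₂)
open import Data.Vec using (Vec; []; _∷_)
open import Function using (_∘_; _⇔_; mk⇔)
open import Function.Properties.Equivalence using () renaming (sym to ⇔-sym)
open import Relation.Binary.PropositionalEquality using (refl; sym; trans; cong; cong₂; subst; subst₂; _≢_; module ≡-Reasoning)
open import Relation.Nullary using (does)
open import Relation.Nullary.Decidable using (T?; _×-dec_; dec-true; dec-false; does-⇔)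
open import Relation.Unary using (Pred; Decidable)

open ≡-Reasoning

[_] : Bool → ℕ
[ true ]  = 1
[ false ] = 0

module _ {A : Set} where

  length-filter≡sum : ∀ {p} {P : Pred A p} (P? : Decidable P) (xs : List A) →
                      length (filter P? xs) ≡ sum (map (λ x → [ does (P? x) ]) xs)
  length-filter≡sum P? []       = refl
  length-filter≡sum P? (x ∷ xs) with does (P? x)
  ... | true  = cong suc (length-filter≡sum P? xs)
  ... | false = length-filter≡sum P? xs

  sum-map-zero : {f : A → ℕ} (xs : List A) → (∀ x → f x ≡ 0) → sum (map f xs) ≡ 0
  sum-map-zero []       _   = refl
  sum-map-zero (x ∷ xs) f≡0 = cong₂ _+_ (f≡0 x) (sum-map-zero xs f≡0)

  sum-map-+ : (f g : A → ℕ) (xs : List A) →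
              sum (map (λ x → f x + g x) xs) ≡ sum (map f xs) + sum (map g xs)
  sum-map-+ f g []       = refl
  sum-map-+ f g (x ∷ xs) =
    trans (cong ((f x + g x) +_) (sum-map-+ f g xs)) (interchange (f x) (g x) _ _)

  sum-map-sumFrom1 : ∀ K (f : ℕ → A → ℕ) (xs : List A) →
                     sum (map (λ x → sumFrom1 K (λ k → f k x)) xs) ≡ sumFrom1 K (λ k → sum (map (f k) xs))
  sum-map-sumFrom1 zero    f xs = sum-map-zero xs (λ _ → refl)
  sum-map-sumFrom1 (suc K) f xs =
    trans (sum-map-+ _ (f (suc K)) xs) (cong (_+ sum (map (f (suc K)) xs)) (sum-map-sumFrom1 K f xs))

sumFrom1-cong : ∀ K {f g : ℕ → ℕ} → (∀ j → j < K → f (suc j) ≡ g (suc j)) → sumFrom1 K f ≡ sumFrom1 K g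
sumFrom1-cong zero    _   = refl
sumFrom1-cong (suc K) f≡g =
  cong₂ _+_ (sumFrom1-cong K (λ j j<K → f≡g j (m<n⇒m<1+n j<K))) (f≡g K (n<1+n K))

sumFrom1-truncate : ∀ {K L} {f : ℕ → ℕ} → K ≤ L → (∀ j → K ≤ j → j < L → f (suc j) ≡ 0) →
                    sumFrom1 L f ≡ sumFrom1 K f
sumFrom1-truncate {L = zero} z≤n _ = refl
sumFrom1-truncate {K} {suc L} {f} K≤1+L tail≡0 with m≤n⇒m<n∨m≡n K≤1+L
... | inj₂ refl = refl
... | inj₁ K<1+L = begin
  sumFrom1 L f + f (suc L) ≡⟨ cong₂ _+_ (sumFrom1-truncate K≤L (λ j K≤j j<L → tail≡0 j K≤j (m<n⇒m<1+n j<L)))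
                                        (tail≡0 L K≤L (n<1+n L)) ⟩
  sumFrom1 K f + 0         ≡⟨ +-identityʳ _ ⟩
  sumFrom1 K f             ∎
  where K≤L = s≤s⁻¹ K<1+L

sumFrom1-select : (b : ℕ → Bool) {v K : ℕ} → v < K →
                  sumFrom1 K (λ k → [ (v ≡ᵇ pred k) ∧ b k ]) ≡ [ b (suc v) ]
sumFrom1-select b {v} {K} v<K = begin
  sumFrom1 K F             ≡⟨ sumFrom1-truncate v<K (λ j v<j _ → off (<⇒≢ v<j)) ⟩
  sumFrom1 v F + F (suc v) ≡⟨ cong₂ _+_ (sumFrom1-truncate z≤n (λ j _ j<v → off (>⇒≢ j<v))) on ⟩
  [ b (suc v) ]            ∎
  where
  F : ℕ → ℕ
  F k = [ (v ≡ᵇ pred k) ∧ b k ]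
  off : ∀ {j} → v ≢ j → F (suc j) ≡ 0
  off {j} v≢j = cong (λ c → [ c ∧ b (suc j) ]) (dec-false (v ≟ j) v≢j)
  on : F (suc v) ≡ [ b (suc v) ]
  on = cong (λ c → [ c ∧ b (suc v) ]) (dec-true (v ≟ v) refl)

≤/⇒*≤ : ∀ {k m d} .{{_ : NonZero d}} → k ≤ m / d → k * d ≤ m
≤/⇒*≤ {k} {m} {d} k≤m/d = ≤-trans (*-monoˡ-≤ d k≤m/d) (m/n*n≤m m d)

*≤⇒≤/ : ∀ {k m d} .{{_ : NonZero d}} → k * d ≤ m → k ≤ m / d
*≤⇒≤/ {k} {m} {d} k*d≤m = subst₂ _≤_ (m*n/n≡m k d) refl (/-monoˡ-≤ d k*d≤m)

C-sym : ∀ m n → (m + n) C m ≡ (m + n) C n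
C-sym m n = trans (nCk≡nC[n∸k] (m≤m+n m n)) (cong ((m + n) C_) (m+n∸m≡n m n))

-- compositions d q: ordered ways of writing d as a sum of q positive parts.
compositions : ℕ → ℕ → ℕ
compositions zero    zero    = 1
compositions zero    (suc q) = 0
compositions (suc d) zero    = 0
compositions (suc d) (suc q) = compositions d (suc q) + compositions d q

-- compositions∸ n s q = compositions (n - s) q, but 0 (rather than compositions 0 q) when n < s.
compositions∸ : ℕ → ℕ → ℕ → ℕ
compositions∸ n       zero    q = compositions n q
compositions∸ zero    (suc s) q = 0
compositions∸ (suc n) (suc s) q = compositions∸ n s q

compositions∸-suc : ∀ n s q → compositions∸ (suc n) s (suc q) ≡ compositions∸ n s (suc q) + compositions∸ n s q
compositions∸-suc n       zero          q = refl
compositions∸-suc zero    (suc zero)    q = refl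
compositions∸-suc zero    (suc (suc s)) q = refl
compositions∸-suc (suc n) (suc s)       q = compositions∸-suc n s q

compositions≡C : ∀ d j → compositions (suc d) (suc j) ≡ d C j
compositions≡C zero    zero    = refl
compositions≡C zero    (suc j) = sym (k>n⇒nCk≡0 {0} {suc j} z<s)
compositions≡C (suc d) zero    = trans (+-identityʳ _) (compositions≡C d zero)
compositions≡C (suc d) (suc j) = begin
  compositions (suc d) (suc (suc j)) + compositions (suc d) (suc j) ≡⟨ cong₂ _+_ (compositions≡C d (suc j)) (compositions≡C d j) ⟩
  d C suc j + d C j                                                ≡⟨ +-comm (d C suc j) (d C j) ⟩
  d C j + d C suc j                                                ≡⟨ nCk+nC[k+1]≡[n+1]C[k+1] d j ⟩
  suc d C suc j                                                    ∎

compositions∸≡C : ∀ {n s} q → s < n → compositions∸ n s (suc q) ≡ (n ∸ suc s) C q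
compositions∸≡C {suc n} {zero}  q _   = compositions≡C n q
compositions∸≡C {suc n} {suc s} q s<n = compositions∸≡C q (s≤s⁻¹ s<n)

compositions-vanishing : ∀ {d q} → d < q → compositions d q ≡ 0
compositions-vanishing {zero}  {suc q} _   = refl
compositions-vanishing {suc d} {suc q} d<q =
  cong₂ _+_ (compositions-vanishing (m<n⇒m<1+n (s≤s⁻¹ d<q))) (compositions-vanishing (s≤s⁻¹ d<q))

compositions∸-vanishing : ∀ {n s q} → n < s + q → compositions∸ n s q ≡ 0
compositions∸-vanishing {n}     {zero}      n<q   = compositions-vanishing n<q
compositions∸-vanishing {zero}  {suc s}     _     = refl
compositions∸-vanishing {suc n} {suc s} {q} n<s+q = compositions∸-vanishing {n} {s} {q} (s≤s⁻¹ n<s+q)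

m⊖n≡1⇒m≡1+n : ∀ m n → m ⊖ n ≡ ℤ.+ 1 → m ≡ suc n
m⊖n≡1⇒m≡1+n zero    zero    ()
m⊖n≡1⇒m≡1+n zero    (suc n) ()
m⊖n≡1⇒m≡1+n (suc m) zero    eq = +-injective eq
m⊖n≡1⇒m≡1+n (suc m) (suc n) eq = cong suc (m⊖n≡1⇒m≡1+n m n (trans (sym ([1+m]⊖[1+n]≡m⊖n m n)) eq))

1+n⊖n≡1 : ∀ n → suc n ⊖ n ≡ ℤ.+ 1
1+n⊖n≡1 zero    = refl
1+n⊖n≡1 (suc n) = trans ([1+m]⊖[1+n]≡m⊖n (suc n) n) (1+n⊖n≡1 n)

m⊖n≡1⇔m≡1+n : ∀ m n → m ⊖ n ≡ ℤ.+ 1 ⇔ m ≡ suc n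
m⊖n≡1⇔m≡1+n m n = mk⇔ (m⊖n≡1⇒m≡1+n m n) (λ { refl → 1+n⊖n≡1 n })

sumSeqs : (n : ℕ) → (Vec Bool n → ℕ) → ℕ
sumSeqs n f = sum (map f (allSeqs n))

sumSeqs-suc : ∀ n (f : Vec Bool (suc n) → ℕ) →
              sumSeqs (suc n) f ≡ sumSeqs n (f ∘ (false ∷_)) + sumSeqs n (f ∘ (true ∷_))
sumSeqs-suc n f = begin
  sum (map f (map (false ∷_) S ++ map (true ∷_) S))             ≡⟨ cong sum (map-++ f (map (false ∷_) S) _) ⟩
  sum (map f (map (false ∷_) S) ++ map f (map (true ∷_) S))     ≡⟨ sum-++ (map f (map (false ∷_) S)) _ ⟩
  sum (map f (map (false ∷_) S)) + sum (map f (map (true ∷_) S)) ≡⟨ cong₂ _+_ (cong sum (map-∘ S)) (cong sum (map-∘ S)) ⟨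
  sumSeqs n (f ∘ (false ∷_)) + sumSeqs n (f ∘ (true ∷_))         ∎
  where S = allSeqs n

count10≤length : ∀ {n} (x : Vec Bool n) → count10 x ≤ n
count10≤length []                  = z≤n
count10≤length (_ ∷ [])            = z≤n
count10≤length (true ∷ false ∷ xs) = s≤s (count10≤length (false ∷ xs))
count10≤length (true ∷ true ∷ xs)  = m≤n⇒m≤1+n (count10≤length (true ∷ xs))
count10≤length (false ∷ b ∷ xs)    = m≤n⇒m≤1+n (count10≤length (b ∷ xs))

score≡1⇔ : ∀ {n} (x : Vec Bool n) → score x ≡ ℤ.+ 1 ⇔ count11 x ≡ suc (count10 x)
score≡1⇔ x = subst (λ i → i ≡ ℤ.+ 1 ⇔ c₁₁ ≡ suc c₁₀) (sym ([+m]-[+n]≡m⊖n c₁₁ c₁₀)) (m⊖n≡1⇔m≡1+n c₁₁ c₁₀)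
  where
  c₁₁ = count11 x
  c₁₀ = count10 x

does-good? : ∀ {n} (x : Vec Bool n) → does (good? x) ≡ lastIsOne x ∧ (count11 x ≡ᵇ suc (count10 x))
does-good? x =
  does-⇔ (⇔-sym T-≡ ×-⇔ score≡1⇔ x) (good? x) (T? (lastIsOne x) ×-dec (count11 x ≟ suc (count10 x)))

-- count10 is tested first: sumFrom1-select needs it there, and it makes the value on 1 ∷ 0 ∷ ys compute.
endsIn1With : ∀ {n} → ℕ → ℕ → Vec Bool n → Bool
endsIn1With p q x = (count10 x ≡ᵇ q) ∧ lastIsOne x ∧ (count11 x ≡ᵇ p)

[good?]≡sumFrom1 : ∀ {n K} → n < K → (x : Vec Bool n) →
                   [ does (good? x) ] ≡ sumFrom1 K (λ k → [ endsIn1With k (pred k) x ])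
[good?]≡sumFrom1 n<K x =
  trans (cong [_] (does-good? x))
        (sym (sumFrom1-select (λ k → lastIsOne x ∧ (count11 x ≡ᵇ k)) (≤-<-trans (count10≤length x) n<K)))

N : Bool → ℕ → ℕ → ℕ → ℕ
N b n p q = sumSeqs n (λ xs → [ endsIn1With p q (b ∷ xs) ])

N-false-suc : ∀ n p q → N false (suc n) p q ≡ N false n p q + N true n p q
N-false-suc n p q = sumSeqs-suc n _

starting11-has-11 : ∀ n q → sumSeqs n (λ ys → [ endsIn1With 0 q (true ∷ true ∷ ys) ]) ≡ 0
starting11-has-11 n q = sum-map-zero (allSeqs n) λ ys →
  cong [_] (trans (cong ((count10 (true ∷ ys) ≡ᵇ q) ∧_) (∧-zeroʳ (lastIsOne (true ∷ ys)))) (∧-zeroʳ _))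

N-false-closed : ∀ n p q → N false n p q ≡ ((p + q) C q) * compositions∸ n (p + q) (suc q)
N-true-closed  : ∀ n p q → N true n p q ≡ ((p + q) C q) * compositions∸ n (p + q) q

N-false-closed zero p q = begin
  [ (0 ≡ᵇ q) ∧ false ∧ (0 ≡ᵇ p) ] + 0               ≡⟨ cong (λ b → [ b ] + 0) (∧-zeroʳ (0 ≡ᵇ q)) ⟩
  0                                                ≡⟨ *-zeroʳ c ⟨
  c * 0                                            ≡⟨ cong (c *_) (compositions∸-vanishing {0} {s} 0<s+1+q) ⟨
  c * compositions∸ zero s (suc q)                 ∎
  where
  s = p + q
  c = s C q
  0<s+1+q = <-≤-trans z<s (m≤n+m (suc q) s)
N-false-closed (suc n) p q = begin
  N false (suc n) p q                                     ≡⟨ N-false-suc n p q ⟩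
  N false n p q + N true n p q                            ≡⟨ cong₂ _+_ (N-false-closed n p q) (N-true-closed n p q) ⟩
  c * compositions∸ n s (suc q) + c * compositions∸ n s q ≡⟨ *-distribˡ-+ c _ _ ⟨
  c * (compositions∸ n s (suc q) + compositions∸ n s q)   ≡⟨ cong (c *_) (compositions∸-suc n s q) ⟨
  c * compositions∸ (suc n) s (suc q)                     ∎
  where
  s = p + q
  c = s C q

N-true-closed zero    zero    zero    = refl
N-true-closed zero    zero    (suc q) = sym (*-zeroʳ (suc q C suc q))
N-true-closed zero    (suc p) zero    = refl
N-true-closed zero    (suc p) (suc q) = sym (*-zeroʳ ((suc p + suc q) C suc q))
N-true-closed (suc n) zero    zero    = begin
  N true (suc n) 0 0                    ≡⟨ sumSeqs-suc n _ ⟩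
  sumSeqs n (λ _ → 0) + _               ≡⟨ cong₂ _+_ (sum-map-zero (allSeqs n) (λ _ → refl)) (starting11-has-11 n 0) ⟩
  0                                     ∎
N-true-closed (suc n) zero    (suc q) = begin
  N true (suc n) 0 (suc q)              ≡⟨ sumSeqs-suc n _ ⟩
  N false n 0 q + _                     ≡⟨ cong₂ _+_ (N-false-closed n 0 q) (starting11-has-11 n (suc q)) ⟩
  (q C q) * e + 0                       ≡⟨ +-identityʳ _ ⟩
  (q C q) * e                           ≡⟨ cong (_* e) (trans (nCn≡1 q) (sym (nCn≡1 (suc q)))) ⟩
  (suc q C suc q) * e                   ∎
  where e = compositions∸ n q (suc q)
N-true-closed (suc n) (suc p) zero    = begin
  N true (suc n) (suc p) 0                  ≡⟨ sumSeqs-suc n _ ⟩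
  sumSeqs n (λ _ → 0) + N true n p 0        ≡⟨ cong (_+ N true n p 0) (sum-map-zero (allSeqs n) (λ _ → refl)) ⟩
  N true n p 0                              ≡⟨ N-true-closed n p 0 ⟩
  ((p + 0) C 0) * compositions∸ n (p + 0) 0 ∎
N-true-closed (suc n) (suc p) (suc q) = begin
  N true (suc n) (suc p) (suc q)                          ≡⟨ sumSeqs-suc n _ ⟩
  N false n (suc p) q + N true n p (suc q)                ≡⟨ cong₂ _+_ (N-false-closed n (suc p) q) (N-true-closed n p (suc q)) ⟩
  (suc (p + q) C q) * e (suc (p + q)) + (s C suc q) * e s ≡⟨ cong (λ t → (t C q) * e t + (s C suc q) * e s) (+-suc p q) ⟨
  (s C q) * e s + (s C suc q) * e s                       ≡⟨ *-distribʳ-+ (e s) (s C q) (s C suc q) ⟨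
  (s C q + s C suc q) * e s                               ≡⟨ cong (_* e s) (nCk+nC[k+1]≡[n+1]C[k+1] s q) ⟩
  (suc s C suc q) * e s                                   ∎
  where
  s = p + suc q
  e : ℕ → ℕ
  e t = compositions∸ n t (suc q)

-- A leading 0 changes none of the counts.
sumSeqs-endsIn1With : ∀ n p q → sumSeqs (suc n) (λ x → [ endsIn1With p q x ]) ≡
                                ((p + q) C q) * compositions∸ (suc n) (p + q) (suc q)
sumSeqs-endsIn1With n p q = begin
  sumSeqs (suc n) (λ x → [ endsIn1With p q x ])         ≡⟨ sumSeqs-suc n _ ⟩
  N false n p q + N true n p q                          ≡⟨ N-false-suc n p q ⟨
  N false (suc n) p q                                   ≡⟨ N-false-closed (suc n) p q ⟩
  ((p + q) C q) * compositions∸ (suc n) (p + q) (suc q) ∎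

3[1+j]≤m+2⇒2j<m : ∀ m j → suc j * 3 ≤ suc m + 1 → j + j < m
3[1+j]≤m+2⇒2j<m m j 3[1+j]≤m+2 =
  ≤-trans (s≤s (m≤m+n (j + j) j)) (+-cancelˡ-≤ 2 _ _ (subst₂ _≤_ (3[1+j] j) (m+2 m) 3[1+j]≤m+2))
  where
  3[1+j] : ∀ j → suc j * 3 ≡ 2 + suc (j + j + j)
  3[1+j] = solve-∀
  m+2 : ∀ m → suc m + 1 ≡ 2 + m
  m+2 = solve-∀

m+2<3[1+j]⇒m<3j+1 : ∀ m j → suc m + 1 < suc j * 3 → m < j + j + suc j
m+2<3[1+j]⇒m<3j+1 m j m+2<3[1+j] = +-cancelˡ-≤ 2 _ _ (subst₂ _≤_ (m+3 m) (3[1+j] j) m+2<3[1+j])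
  where
  m+3 : ∀ m → suc (suc m + 1) ≡ 2 + suc m
  m+3 = solve-∀
  3[1+j] : ∀ j → suc j * 3 ≡ 2 + (j + j + suc j)
  3[1+j] = solve-∀

h₂-term-vanishing : ∀ m j → (suc m + 1) / 3 ≤ j → sumSeqs (suc m) (λ x → [ endsIn1With (suc j) j x ]) ≡ 0
h₂-term-vanishing m j K≤j = begin
  sumSeqs (suc m) (λ x → [ endsIn1With (suc j) j x ]) ≡⟨ sumSeqs-endsIn1With m (suc j) j ⟩
  c * compositions∸ m (j + j) (suc j)                 ≡⟨ cong (c *_) (compositions∸-vanishing {m} {j + j} {suc j} m<3j+1) ⟩
  c * 0                                               ≡⟨ *-zeroʳ c ⟩
  0                                                   ∎
  where
  c = suc (j + j) C j
  m<3j+1 : m < j + j + suc j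
  m<3j+1 = m+2<3[1+j]⇒m<3j+1 m j (≰⇒> (λ 3[1+j]≤m+2 → n≮n j (≤-trans (*≤⇒≤/ 3[1+j]≤m+2) K≤j)))

h₂-term≡rhs-term : ∀ m j → j < (suc m + 1) / 3 →
                   sumSeqs (suc m) (λ x → [ endsIn1With (suc j) j x ]) ≡
                   ((2 * suc j ∸ 1) C suc j) * ((suc m ∸ 2 * suc j) C (suc j ∸ 1))
h₂-term≡rhs-term m j j<K = begin
  sumSeqs (suc m) (λ x → [ endsIn1With (suc j) j x ])             ≡⟨ sumSeqs-endsIn1With m (suc j) j ⟩
  (suc (j + j) C j) * compositions∸ m (j + j) (suc j)             ≡⟨ cong ((suc (j + j) C j) *_) (compositions∸≡C j 2j<m) ⟩
  (suc (j + j) C j) * ((m ∸ suc (j + j)) C j)                     ≡⟨ cong (λ t → (t C j) * ((m ∸ t) C j)) (+-suc j j) ⟨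
  ((j + suc j) C j) * ((m ∸ (j + suc j)) C j)                     ≡⟨ cong (_* ((m ∸ (j + suc j)) C j)) (C-sym j (suc j)) ⟩
  ((j + suc j) C suc j) * ((m ∸ (j + suc j)) C j)                 ≡⟨ cong (λ t → ((j + suc t) C suc j) * ((m ∸ (j + suc t)) C j))
                                                                          (+-identityʳ j) ⟨
  ((2 * suc j ∸ 1) C suc j) * ((suc m ∸ 2 * suc j) C (suc j ∸ 1)) ∎
  where
  2j<m : j + j < m
  2j<m = 3[1+j]≤m+2⇒2j<m m j (≤/⇒*≤ j<K)

mainTheorem5 : (m : ℕ) → h₂ (suc m) ≡ rhs (suc m)
mainTheorem5 m = begin
  h₂ (suc m)
    ≡⟨ length-filter≡sum good? (allSeqs (suc m)) ⟩
  sumSeqs (suc m) (λ x → [ does (good? x) ])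
    ≡⟨ cong sum (map-cong ([good?]≡sumFrom1 (m<m+n (suc m) z<s)) (allSeqs (suc m))) ⟩
  sumSeqs (suc m) (λ x → sumFrom1 L (λ k → [ endsIn1With k (pred k) x ]))
    ≡⟨ sum-map-sumFrom1 L _ (allSeqs (suc m)) ⟩
  sumFrom1 L (λ k → sumSeqs (suc m) (λ x → [ endsIn1With k (pred k) x ]))
    ≡⟨ sumFrom1-truncate (m/n≤m L 3) (λ j K≤j _ → h₂-term-vanishing m j K≤j) ⟩
  sumFrom1 (L / 3) (λ k → sumSeqs (suc m) (λ x → [ endsIn1With k (pred k) x ]))
    ≡⟨ sumFrom1-cong (L / 3) (h₂-term≡rhs-term m) ⟩
  rhs (suc m) ∎
  where L = suc m + 1
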